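{- Let $q$ be an indeterminate, and define Laurent polynomials $A_n^r(q)$ for integers $n\ge 0$, $r\ge 0$ by $A_0^0(q)=1$, $A_0^r(q)=0$ for $r\ge 1$, $A_{n}^{0}(q)=1$ for all $n\ge 0$, and for all $n\ge 0$, $r\ge 0$, $$A_{n+1}^{r+1}(q)=q^{r+1}A_n^{r+1}(q)+(q^{n-r}-q^r)A_n^r(q).$$ Then for all integers $n\ge 0$, $r\ge 0$, $$A_n^r(q)=\mathrm{CT}_w\left[\frac{(1-w)(1+w)^n q^{r(n-r)}}{w^r}\sum_{i=0}^{\infty}(-1)^i q^{ -(i+1)i/2-i(n-2r)}\binom{i+n-2r}{i}_q w^i\right].$$
   Context: For a formal Laurent series $P(w)$ (finitely many negative powers of $w$), $\mathrm{CT}_w P(w)$ denotes the coefficient of $w^0$. The $q$-binomial coefficient is defined by $\binom{M}{k}_q=\frac{(1-q^M)(1-q^{M-1})\cdots(1-q^{M-k+1})}{(1-q)(1-q^2)\cdots(1-q^k)}$ whenever $0\le k\le M$, and $\binom{M}{k}_q=0$ otherwise. -}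

module Defs where

open import Data.Nat as ℕ using (ℕ; zero; suc)
open import Data.Integer as ℤ using (ℤ; +_; -[1+_])
open import Data.List using (List; []; _∷_; map; replicate; _++_)
open import Data.Product using (_×_; _,_)
open import Relation.Binary.PropositionalEquality using (_≡_)

-- Laurent polynomials in q with integer coefficients.
-- (e , c₀ ∷ c₁ ∷ … ∷ cₖ ∷ [])  represents  Σⱼ cⱼ q^(e + j).

LP : Set
LP = ℤ × List ℤ

addL : List ℤ → List ℤ → List ℤ
addL [] ys = ys
addL (x ∷ xs) [] = x ∷ xs
addL (x ∷ xs) (y ∷ ys) = (x ℤ.+ y) ∷ addL xs ys

mulL : List ℤ → List ℤ → List ℤ
mulL [] ys = []
mulL (x ∷ xs) ys = addL (map (x ℤ.*_) ys) (ℤ.0ℤ ∷ mulL xs ys)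

pad : ℕ → List ℤ → List ℤ
pad d cs = replicate d ℤ.0ℤ ++ cs

infixl 6 _⊕_
infixl 7 _⊛_

_⊕_ : LP → LP → LP
(e , cs) ⊕ (f , ds) =
  let m = e ℤ.⊓ f in
  (m , addL (pad ℤ.∣ e ℤ.- m ∣ cs) (pad ℤ.∣ f ℤ.- m ∣ ds))

⊖_ : LP → LP
⊖ (e , cs) = (e , map ℤ.-_ cs)

_⊛_ : LP → LP → LP
(e , cs) ⊛ (f , ds) = (e ℤ.+ f , mulL cs ds)

qpow : ℤ → LP
qpow z = (z , ℤ.1ℤ ∷ [])

𝟘 𝟙 : LP
𝟘 = (ℤ.0ℤ , [])
𝟙 = qpow ℤ.0ℤ

lookupOr : List ℤ → ℕ → ℤ
lookupOr [] k = ℤ.0ℤ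
lookupOr (c ∷ cs) zero = c
lookupOr (c ∷ cs) (suc k) = lookupOr cs k

coeff : LP → ℤ → ℤ
coeff (e , cs) m with m ℤ.- e
... | + k = lookupOr cs k
... | -[1+ _ ] = ℤ.0ℤ

infix 4 _≈_
_≈_ : LP → LP → Set
a ≈ b = ∀ m → coeff a m ≡ coeff b m

A : ℕ → ℕ → LP
A zero zero = 𝟙
A zero (suc r) = 𝟘
A (suc n) zero = 𝟙
A (suc n) (suc r) =
  qpow (+ suc r) ⊛ A n (suc r) ⊕ (qpow (+ n ℤ.- + r) ⊕ ⊖ qpow (+ r)) ⊛ A n r

-- Gaussian (q-)binomial coefficients [M choose k]_q, via q-Pascal:
-- [M,0]=1, [0,k+1]=0, [M+1,k+1] = [M,k] + q^(k+1) [M,k+1].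
-- (This equals the product quotient of the paper for 0 ≤ k ≤ M and is 0 for k > M.)

qbinom : ℕ → ℕ → LP
qbinom M zero = 𝟙
qbinom zero (suc k) = 𝟘
qbinom (suc M) (suc k) = qbinom M k ⊕ qpow (+ suc k) ⊛ qbinom M (suc k)

qbinomℤ : ℤ → ℕ → LP
qbinomℤ (+ M) k = qbinom M k
qbinomℤ -[1+ _ ] k = 𝟘

-- Formal Laurent series in w (finitely many negative powers) with
-- coefficients in LP:  (m , f)  represents  Σ_{i ≥ 0} f i · w^(i - m).

WSeries : Set
WSeries = ℕ × (ℕ → LP)

conv : (ℕ → LP) → (ℕ → LP) → ℕ → LP
conv f g i = go i
  where
  go : ℕ → LP
  go zero = f zero ⊛ g i
  go (suc k) = go k ⊕ f (suc k) ⊛ g (i ℕ.∸ suc k)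

infixl 7 _⊗_
_⊗_ : WSeries → WSeries → WSeries
(m , f) ⊗ (n , g) = (m ℕ.+ n , conv f g)

CT : WSeries → LP
CT (m , f) = f m

fromList : List LP → ℕ → LP
fromList [] i = 𝟘
fromList (c ∷ cs) zero = c
fromList (c ∷ cs) (suc i) = fromList cs i

constW : LP → WSeries
constW c = (0 , fromList (c ∷ []))

oneMinusW onePlusW : WSeries
oneMinusW = (0 , fromList (𝟙 ∷ ⊖ 𝟙 ∷ []))
onePlusW  = (0 , fromList (𝟙 ∷ 𝟙 ∷ []))

powW : WSeries → ℕ → WSeries
powW s zero = constW 𝟙
powW s (suc n) = s ⊗ powW s n

wInv : ℕ → WSeries
wInv r = (r , fromList (𝟙 ∷ []))

sgn : ℕ → LP
sgn zero = 𝟙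
sgn (suc i) = ⊖ sgn i

Sser : ℕ → ℕ → WSeries
Sser n r = (0 , λ i →
  sgn i
  ⊛ qpow (ℤ.- (+ ((suc i ℕ.* i) ℕ./ 2)) ℤ.- (+ i) ℤ.* (+ n ℤ.- + (2 ℕ.* r)))
  ⊛ qbinomℤ (+ i ℤ.+ (+ n ℤ.- + (2 ℕ.* r))) i)

RHS : ℕ → ℕ → LP
RHS n r = CT (oneMinusW ⊗ powW onePlusW n ⊗ constW (qpow (+ r ℤ.* (+ n ℤ.- + r))) ⊗ wInv r ⊗ Sser n r)

{-# OPTIONS --safe #-}
module Submission where

-- Let c_n(j) = C(n,j) − C(n,j−1) (binomialDiff n j) be the coefficient of w^j in
-- (1−w)(1+w)^n and T_D(i) = (−1)^i q^(−i(i+1)/2 − iD) [i+D choose i]_q (term D i), so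
-- that the series is Σ_i T_{n−2r}(i) w^i.  The right-hand side is q^(r(n−r)) B(n,r)
-- with B(n,r) = Σ_{j≤r} c_n(j) T_{n−2r}(r−j) (ctSum n r), and the recurrence of A
-- becomes B(n+1,r+1) = B(n,r+1) + (1 − q^(−(n−2r))) B(n,r).  This follows from
-- Pascal's rule for c_n and the three-term identity
--   T_D(i+1) + T_D(i) = T_{D−1}(i+1) + (1 − q^(−(D+1))) T_{D+1}(i)
-- for D = n − 2r − 1, itself a consequence of q-Pascal and
-- (q^(M+1) − 1)[M,i] = (q^(M+1−i) − 1)[M+1,i].  What is left over is the boundary term
-- c_n(r+1)(T_D(0) − T_{D−1}(0)), which can only be nonzero when D = 0, i.e. n = 2r+1,
-- and then c_n(r+1) = 0 by the symmetry of binomial coefficients.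

open import Algebra.Bundles using (CommutativeRing)
open import Data.Empty using (⊥-elim)
open import Data.Integer as ℤ using (ℤ; +_; -[1+_]; _+_; _*_; -_; _-_; _⊓_; ∣_∣)
import Data.Integer.Properties as ℤP
open import Data.Integer.Tactic.RingSolver using (solve-∀)
open import Data.List using (List; []; _∷_; map)
open import Data.Maybe as Maybe using (Maybe; just; nothing)
open import Data.Nat as ℕ using (ℕ; zero; suc; _∸_; z≤n; s≤s)
open import Data.Nat.Combinatorics using (_C_; nCk≡nC[n∸k]; nCk+nC[k+1]≡[n+1]C[k+1])
open import Data.Nat.DivMod using (m*n/n≡m; +-distrib-/-∣ʳ)
open import Data.Nat.Divisibility using (divides)
import Data.Nat.Properties as ℕP
import Data.Nat.Tactic.RingSolver as ℕ-Solver
open import Data.Product using (_,_; proj₁; proj₂)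
open import Function using (_∘_)
open import Relation.Binary.PropositionalEquality
  using (_≡_; _≢_; refl; sym; trans; cong; cong₂; subst; module ≡-Reasoning)
open import Relation.Nullary using (yes; no)
import Tactic.RingSolver as RingSolver
import Tactic.RingSolver.Core.AlmostCommutativeRing as ACR
open import Defs

-- Arithmetic of coefficient lists

record _≋_ (xs ys : List ℤ) : Set where
  constructor mk≋
  field at : ∀ k → lookupOr xs k ≡ lookupOr ys k
open _≋_

≋-refl : ∀ {xs} → xs ≋ xs
≋-refl .at k = refl

≋-sym : ∀ {xs ys} → xs ≋ ys → ys ≋ xs
≋-sym p .at k = sym (at p k)

≋-trans : ∀ {xs ys zs} → xs ≋ ys → ys ≋ zs → xs ≋ zs
≋-trans p q .at k = trans (at p k) (at q k)

∷-cong : ∀ {x y xs ys} → x ≡ y → xs ≋ ys → (x ∷ xs) ≋ (y ∷ ys)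
∷-cong x≡y _ .at zero = x≡y
∷-cong _ p .at (suc k) = at p k

lookupOr-addL : ∀ xs ys k → lookupOr (addL xs ys) k ≡ lookupOr xs k + lookupOr ys k
lookupOr-addL [] ys k = sym (ℤP.+-identityˡ _)
lookupOr-addL (x ∷ xs) [] k = sym (ℤP.+-identityʳ _)
lookupOr-addL (x ∷ xs) (y ∷ ys) zero = refl
lookupOr-addL (x ∷ xs) (y ∷ ys) (suc k) = lookupOr-addL xs ys k

lookupOr-map : ∀ (f : ℤ → ℤ) → f ℤ.0ℤ ≡ ℤ.0ℤ → ∀ xs k → lookupOr (map f xs) k ≡ f (lookupOr xs k)
lookupOr-map f f0≡0 [] k = sym f0≡0
lookupOr-map f f0≡0 (x ∷ xs) zero = refl
lookupOr-map f f0≡0 (x ∷ xs) (suc k) = lookupOr-map f f0≡0 xs k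

lookupOr-scaleˡ : ∀ x xs k → lookupOr (map (x *_) xs) k ≡ x * lookupOr xs k
lookupOr-scaleˡ x = lookupOr-map (x *_) (ℤP.*-zeroʳ x)

lookupOr-scaleʳ : ∀ y xs k → lookupOr (map (_* y) xs) k ≡ lookupOr xs k * y
lookupOr-scaleʳ y = lookupOr-map (_* y) (ℤP.*-zeroˡ y)

addL-cong : ∀ {xs xs′ ys ys′} → xs ≋ xs′ → ys ≋ ys′ → addL xs ys ≋ addL xs′ ys′
addL-cong {xs} {xs′} {ys} {ys′} p q .at k = begin
  lookupOr (addL xs ys) k          ≡⟨ lookupOr-addL xs ys k ⟩
  lookupOr xs k + lookupOr ys k    ≡⟨ cong₂ _+_ (at p k) (at q k) ⟩
  lookupOr xs′ k + lookupOr ys′ k  ≡⟨ lookupOr-addL xs′ ys′ k ⟨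
  lookupOr (addL xs′ ys′) k        ∎
  where open ≡-Reasoning

lookupOr-mulL-∷ : ∀ x xs ys k →
  lookupOr (mulL (x ∷ xs) ys) k ≡ x * lookupOr ys k + lookupOr (ℤ.0ℤ ∷ mulL xs ys) k
lookupOr-mulL-∷ x xs ys k =
  trans (lookupOr-addL (map (x *_) ys) _ k) (cong (_+ _) (lookupOr-scaleˡ x ys k))

lookupOr-addL-scaleʳ : ∀ y xs zs k →
  lookupOr (addL (map (_* y) xs) zs) k ≡ lookupOr xs k * y + lookupOr zs k
lookupOr-addL-scaleʳ y xs zs k =
  trans (lookupOr-addL (map (_* y) xs) zs k) (cong (_+ _) (lookupOr-scaleʳ y xs k))

mulL-zeroʳ : ∀ xs → mulL xs [] ≋ []
mulL-zeroʳ [] .at k = refl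
mulL-zeroʳ (x ∷ xs) .at zero = refl
mulL-zeroʳ (x ∷ xs) .at (suc k) = at (mulL-zeroʳ xs) k

mulL-∷ʳ : ∀ xs y ys → mulL xs (y ∷ ys) ≋ addL (map (_* y) xs) (ℤ.0ℤ ∷ mulL xs ys)
mulL-∷ʳ [] y ys .at zero = refl
mulL-∷ʳ [] y ys .at (suc k) = refl
mulL-∷ʳ (x ∷ xs) y ys .at zero = refl
mulL-∷ʳ (x ∷ xs) y ys .at (suc k) = begin
  lookupOr (mulL (x ∷ xs) (y ∷ ys)) (suc k)
    ≡⟨ lookupOr-mulL-∷ x xs (y ∷ ys) (suc k) ⟩
  x * lookupOr ys k + lookupOr (mulL xs (y ∷ ys)) k
    ≡⟨ cong (_+_ (x * lookupOr ys k)) (trans (at (mulL-∷ʳ xs y ys) k) (lookupOr-addL-scaleʳ y xs _ k)) ⟩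
  x * lookupOr ys k + (lookupOr xs k * y + lookupOr (ℤ.0ℤ ∷ mulL xs ys) k)
    ≡⟨ swap (x * lookupOr ys k) (lookupOr xs k * y) _ ⟩
  lookupOr xs k * y + (x * lookupOr ys k + lookupOr (ℤ.0ℤ ∷ mulL xs ys) k)
    ≡⟨ cong (_+_ (lookupOr xs k * y)) (lookupOr-mulL-∷ x xs ys k) ⟨
  lookupOr xs k * y + lookupOr (mulL (x ∷ xs) ys) k
    ≡⟨ lookupOr-addL-scaleʳ y xs _ k ⟨
  lookupOr (addL (map (_* y) xs) (mulL (x ∷ xs) ys)) k
    ∎
  where
  open ≡-Reasoning
  swap : ∀ a b c → a + (b + c) ≡ b + (a + c)
  swap = solve-∀

mulL-comm : ∀ xs ys → mulL xs ys ≋ mulL ys xs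
mulL-comm [] ys = ≋-sym (mulL-zeroʳ ys)
mulL-comm (x ∷ xs) ys =
  ≋-trans (addL-cong scale-comm (∷-cong refl (mulL-comm xs ys))) (≋-sym (mulL-∷ʳ ys x xs))
  where
  scale-comm : map (x *_) ys ≋ map (_* x) ys
  scale-comm .at k =
    trans (lookupOr-scaleˡ x ys k) (trans (ℤP.*-comm x _) (sym (lookupOr-scaleʳ x ys k)))

mulL-distribʳ : ∀ xs ys zs → mulL (addL xs ys) zs ≋ addL (mulL xs zs) (mulL ys zs)
mulL-distribʳ [] ys zs .at k = refl
mulL-distribʳ (x ∷ xs) [] zs .at k = sym (trans (lookupOr-addL (mulL (x ∷ xs) zs) [] k) (ℤP.+-identityʳ _))
mulL-distribʳ (x ∷ xs) (y ∷ ys) zs .at k = begin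
  lookupOr (mulL (x + y ∷ addL xs ys) zs) k
    ≡⟨ lookupOr-mulL-∷ (x + y) (addL xs ys) zs k ⟩
  (x + y) * z + lookupOr (ℤ.0ℤ ∷ mulL (addL xs ys) zs) k
    ≡⟨ cong (_+_ ((x + y) * z)) (trans (at (∷-cong refl (mulL-distribʳ xs ys zs)) k)
                                        (lookupOr-addL (ℤ.0ℤ ∷ _) (ℤ.0ℤ ∷ _) k)) ⟩
  (x + y) * z + (lookupOr (ℤ.0ℤ ∷ mulL xs zs) k + lookupOr (ℤ.0ℤ ∷ mulL ys zs) k)
    ≡⟨ regroup x y z _ _ ⟩
  (x * z + lookupOr (ℤ.0ℤ ∷ mulL xs zs) k) + (y * z + lookupOr (ℤ.0ℤ ∷ mulL ys zs) k)
    ≡⟨ cong₂ _+_ (lookupOr-mulL-∷ x xs zs k) (lookupOr-mulL-∷ y ys zs k) ⟨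
  lookupOr (mulL (x ∷ xs) zs) k + lookupOr (mulL (y ∷ ys) zs) k
    ≡⟨ lookupOr-addL (mulL (x ∷ xs) zs) _ k ⟨
  lookupOr (addL (mulL (x ∷ xs) zs) (mulL (y ∷ ys) zs)) k
    ∎
  where
  open ≡-Reasoning
  z = lookupOr zs k
  regroup : ∀ x y z u v → (x + y) * z + (u + v) ≡ (x * z + u) + (y * z + v)
  regroup = solve-∀

mulL-scaleˡ : ∀ c xs zs → mulL (map (c *_) xs) zs ≋ map (c *_) (mulL xs zs)
mulL-scaleˡ c [] zs .at k = refl
mulL-scaleˡ c (x ∷ xs) zs .at k = begin
  lookupOr (mulL (c * x ∷ map (c *_) xs) zs) k
    ≡⟨ lookupOr-mulL-∷ (c * x) (map (c *_) xs) zs k ⟩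
  (c * x) * z + lookupOr (ℤ.0ℤ ∷ mulL (map (c *_) xs) zs) k
    ≡⟨ cong (_+_ ((c * x) * z)) (trans (at (∷-cong (sym (ℤP.*-zeroʳ c)) (mulL-scaleˡ c xs zs)) k)
                                        (lookupOr-scaleˡ c (ℤ.0ℤ ∷ mulL xs zs) k)) ⟩
  (c * x) * z + c * lookupOr (ℤ.0ℤ ∷ mulL xs zs) k
    ≡⟨ factor c x z _ ⟩
  c * (x * z + lookupOr (ℤ.0ℤ ∷ mulL xs zs) k)
    ≡⟨ cong (c *_) (lookupOr-mulL-∷ x xs zs k) ⟨
  c * lookupOr (mulL (x ∷ xs) zs) k
    ≡⟨ lookupOr-scaleˡ c (mulL (x ∷ xs) zs) k ⟨
  lookupOr (map (c *_) (mulL (x ∷ xs) zs)) k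
    ∎
  where
  open ≡-Reasoning
  z = lookupOr zs k
  factor : ∀ c x z u → (c * x) * z + c * u ≡ c * (x * z + u)
  factor = solve-∀

mulL-shiftˡ : ∀ xs zs → mulL (ℤ.0ℤ ∷ xs) zs ≋ (ℤ.0ℤ ∷ mulL xs zs)
mulL-shiftˡ xs zs .at k =
  trans (lookupOr-mulL-∷ ℤ.0ℤ xs zs k) (ℤP.+-identityˡ _)

mulL-assoc : ∀ xs ys zs → mulL (mulL xs ys) zs ≋ mulL xs (mulL ys zs)
mulL-assoc [] ys zs .at k = refl
mulL-assoc (x ∷ xs) ys zs =
  ≋-trans (mulL-distribʳ (map (x *_) ys) (ℤ.0ℤ ∷ mulL xs ys) zs)
    (addL-cong (mulL-scaleˡ x ys zs)
               (≋-trans (mulL-shiftˡ (mulL xs ys) zs) (∷-cong refl (mulL-assoc xs ys zs))))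

-- The commutative ring of Laurent polynomials

lookupZ : List ℤ → ℤ → ℤ
lookupZ cs (+ k) = lookupOr cs k
lookupZ cs -[1+ _ ] = ℤ.0ℤ

coeff≡lookupZ : ∀ e cs m → coeff (e , cs) m ≡ lookupZ cs (m - e)
coeff≡lookupZ e cs m with m - e
... | + k = refl
... | -[1+ _ ] = refl

lookupZ-[] : ∀ z → lookupZ [] z ≡ ℤ.0ℤ
lookupZ-[] (+ k) = refl
lookupZ-[] -[1+ _ ] = refl

lookupZ-0∷ : ∀ cs z → lookupZ (ℤ.0ℤ ∷ cs) z ≡ lookupZ cs (z - ℤ.1ℤ)
lookupZ-0∷ cs (+ zero) = refl
lookupZ-0∷ cs (+ suc k) = refl
lookupZ-0∷ cs -[1+ _ ] = refl

lookupZ-cong : ∀ {xs ys} → xs ≋ ys → ∀ z → lookupZ xs z ≡ lookupZ ys z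
lookupZ-cong p (+ k) = at p k
lookupZ-cong p -[1+ _ ] = refl

lookupZ-addL : ∀ xs ys z → lookupZ (addL xs ys) z ≡ lookupZ xs z + lookupZ ys z
lookupZ-addL xs ys (+ k) = lookupOr-addL xs ys k
lookupZ-addL xs ys -[1+ _ ] = refl

lookupZ-map : ∀ (f : ℤ → ℤ) → f ℤ.0ℤ ≡ ℤ.0ℤ → ∀ xs z → lookupZ (map f xs) z ≡ f (lookupZ xs z)
lookupZ-map f f0≡0 xs (+ k) = lookupOr-map f f0≡0 xs k
lookupZ-map f f0≡0 xs -[1+ _ ] = sym f0≡0

lookupZ-pad : ∀ d cs z → lookupZ (pad d cs) z ≡ lookupZ cs (z - + d)
lookupZ-pad zero cs z = cong (lookupZ cs) (sym (ℤP.+-identityʳ z))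
lookupZ-pad (suc d) cs z = begin
  lookupZ (ℤ.0ℤ ∷ pad d cs) z         ≡⟨ lookupZ-0∷ (pad d cs) z ⟩
  lookupZ (pad d cs) (z - ℤ.1ℤ)       ≡⟨ lookupZ-pad d cs (z - ℤ.1ℤ) ⟩
  lookupZ cs (z - ℤ.1ℤ - + d)         ≡⟨ cong (lookupZ cs) (shift z (+ d)) ⟩
  lookupZ cs (z - + suc d)            ∎
  where
  open ≡-Reasoning
  shift : ∀ z t → z - ℤ.1ℤ - t ≡ z - (ℤ.1ℤ + t)
  shift = solve-∀

-- A record around Defs._≈_, so that both sides can be inferred from a proof.
infix 4 _≃_
record _≃_ (a b : LP) : Set where
  constructor mk≃
  field get : a ≈ b
open _≃_

≃-refl : ∀ {a} → a ≃ a
≃-refl .get m = refl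

≃-sym : ∀ {a b} → a ≃ b → b ≃ a
≃-sym p .get m = sym (get p m)

≃-trans : ∀ {a b c} → a ≃ b → b ≃ c → a ≃ c
≃-trans p q .get m = trans (get p m) (get q m)

≃-reflexive : ∀ {a b} → a ≡ b → a ≃ b
≃-reflexive refl = ≃-refl

,-cong : ∀ {e e′ cs cs′} → e ≡ e′ → cs ≋ cs′ → (e , cs) ≃ (e′ , cs′)
,-cong {e} {_} {cs} {cs′} refl p .get m =
  trans (coeff≡lookupZ e cs m) (trans (lookupZ-cong p (m - e)) (sym (coeff≡lookupZ e cs′ m)))

coeff-𝟘 : ∀ m → coeff 𝟘 m ≡ ℤ.0ℤ
coeff-𝟘 m = trans (coeff≡lookupZ ℤ.0ℤ [] m) (lookupZ-[] (m - ℤ.0ℤ))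

coeff-⊖ : ∀ a m → coeff (⊖ a) m ≡ - coeff a m
coeff-⊖ (e , cs) m = begin
  coeff (e , map -_ cs) m      ≡⟨ coeff≡lookupZ e _ m ⟩
  lookupZ (map -_ cs) (m - e)  ≡⟨ lookupZ-map -_ refl cs (m - e) ⟩
  - lookupZ cs (m - e)         ≡⟨ cong -_ (coeff≡lookupZ e cs m) ⟨
  - coeff (e , cs) m           ∎
  where open ≡-Reasoning

coeff-⊕ : ∀ a b m → coeff (a ⊕ b) m ≡ coeff a m + coeff b m
coeff-⊕ (e , cs) (f , ds) m = begin
  coeff (e ⊓ f , addL (pad ∣ e - e ⊓ f ∣ cs) (pad ∣ f - e ⊓ f ∣ ds)) m
    ≡⟨ coeff≡lookupZ (e ⊓ f) _ m ⟩
  lookupZ (addL (pad ∣ e - e ⊓ f ∣ cs) (pad ∣ f - e ⊓ f ∣ ds)) (m - e ⊓ f)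
    ≡⟨ lookupZ-addL (pad ∣ e - e ⊓ f ∣ cs) _ (m - e ⊓ f) ⟩
  lookupZ (pad ∣ e - e ⊓ f ∣ cs) (m - e ⊓ f) + lookupZ (pad ∣ f - e ⊓ f ∣ ds) (m - e ⊓ f)
    ≡⟨ cong₂ _+_ (unpad e cs (ℤP.i⊓j≤i e f)) (unpad f ds (ℤP.i⊓j≤j e f)) ⟩
  coeff (e , cs) m + coeff (f , ds) m
    ∎
  where
  open ≡-Reasoning
  u = e ⊓ f
  cancel : ∀ m u x → m - u - (x - u) ≡ m - x
  cancel = solve-∀
  unpad : ∀ x xs → u ℤ.≤ x → lookupZ (pad ∣ x - u ∣ xs) (m - u) ≡ coeff (x , xs) m
  unpad x xs u≤x = begin
    lookupZ (pad ∣ x - u ∣ xs) (m - u)   ≡⟨ lookupZ-pad ∣ x - u ∣ xs (m - u) ⟩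
    lookupZ xs (m - u - + ∣ x - u ∣)     ≡⟨ cong (λ t → lookupZ xs (m - u - t)) (ℤP.0≤i⇒+∣i∣≡i (ℤP.i≤j⇒0≤j-i u≤x)) ⟩
    lookupZ xs (m - u - (x - u))         ≡⟨ cong (lookupZ xs) (cancel m u x) ⟩
    lookupZ xs (m - x)                   ≡⟨ coeff≡lookupZ x xs m ⟨
    coeff (x , xs) m                     ∎

coeff-[]⊛ : ∀ e b m → coeff ((e , []) ⊛ b) m ≡ ℤ.0ℤ
coeff-[]⊛ e (f , ds) m = trans (coeff≡lookupZ (e + f) [] m) (lookupZ-[] (m - (e + f)))

coeff-∷⊛ : ∀ e x xs b m →
  coeff ((e , x ∷ xs) ⊛ b) m ≡ x * coeff b (m - e) + coeff ((e + ℤ.1ℤ , xs) ⊛ b) m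
coeff-∷⊛ e x xs (f , ds) m = begin
  coeff (e + f , mulL (x ∷ xs) ds) m
    ≡⟨ coeff≡lookupZ (e + f) _ m ⟩
  lookupZ (addL (map (x *_) ds) (ℤ.0ℤ ∷ mulL xs ds)) (m - (e + f))
    ≡⟨ lookupZ-addL (map (x *_) ds) _ (m - (e + f)) ⟩
  lookupZ (map (x *_) ds) (m - (e + f)) + lookupZ (ℤ.0ℤ ∷ mulL xs ds) (m - (e + f))
    ≡⟨ cong₂ _+_ (lookupZ-map (x *_) (ℤP.*-zeroʳ x) ds (m - (e + f))) (lookupZ-0∷ (mulL xs ds) (m - (e + f))) ⟩
  x * lookupZ ds (m - (e + f)) + lookupZ (mulL xs ds) (m - (e + f) - ℤ.1ℤ)
    ≡⟨ cong₂ (λ s t → x * lookupZ ds s + lookupZ (mulL xs ds) t) (shift₁ m e f) (shift₂ m e f) ⟩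
  x * lookupZ ds (m - e - f) + lookupZ (mulL xs ds) (m - (e + ℤ.1ℤ + f))
    ≡⟨ cong₂ (λ s t → x * s + t) (coeff≡lookupZ f ds (m - e)) (coeff≡lookupZ _ (mulL xs ds) m) ⟨
  x * coeff (f , ds) (m - e) + coeff (e + ℤ.1ℤ + f , mulL xs ds) m
    ∎
  where
  open ≡-Reasoning
  shift₁ : ∀ m e f → m - (e + f) ≡ m - e - f
  shift₁ = solve-∀
  shift₂ : ∀ m e f → m - (e + f) - ℤ.1ℤ ≡ m - (e + ℤ.1ℤ + f)
  shift₂ = solve-∀

⊕-cong : ∀ {a a′ b b′} → a ≃ a′ → b ≃ b′ → a ⊕ b ≃ a′ ⊕ b′
⊕-cong {a} {a′} {b} {b′} p q .get m =
  trans (coeff-⊕ a b m) (trans (cong₂ _+_ (get p m) (get q m)) (sym (coeff-⊕ a′ b′ m)))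

⊕-congˡ : ∀ a {b b′} → b ≃ b′ → a ⊕ b ≃ a ⊕ b′
⊕-congˡ a = ⊕-cong (≃-refl {a})

⊕-congʳ : ∀ a {b b′} → b ≃ b′ → b ⊕ a ≃ b′ ⊕ a
⊕-congʳ a b≃b′ = ⊕-cong b≃b′ (≃-refl {a})

⊕-assoc : ∀ a b c → (a ⊕ b) ⊕ c ≃ a ⊕ (b ⊕ c)
⊕-assoc a b c .get m = begin
  coeff ((a ⊕ b) ⊕ c) m                ≡⟨ coeff-⊕ (a ⊕ b) c m ⟩
  coeff (a ⊕ b) m + coeff c m          ≡⟨ cong (_+ coeff c m) (coeff-⊕ a b m) ⟩
  coeff a m + coeff b m + coeff c m    ≡⟨ ℤP.+-assoc (coeff a m) _ _ ⟩
  coeff a m + (coeff b m + coeff c m)  ≡⟨ cong (_+_ (coeff a m)) (coeff-⊕ b c m) ⟨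
  coeff a m + coeff (b ⊕ c) m          ≡⟨ coeff-⊕ a (b ⊕ c) m ⟨
  coeff (a ⊕ (b ⊕ c)) m                ∎
  where open ≡-Reasoning

⊕-comm : ∀ a b → a ⊕ b ≃ b ⊕ a
⊕-comm a b .get m = trans (coeff-⊕ a b m) (trans (ℤP.+-comm (coeff a m) _) (sym (coeff-⊕ b a m)))

⊕-identityˡ : ∀ a → 𝟘 ⊕ a ≃ a
⊕-identityˡ a .get m = trans (coeff-⊕ 𝟘 a m) (trans (cong (_+ coeff a m) (coeff-𝟘 m)) (ℤP.+-identityˡ _))

⊕-identityʳ : ∀ a → a ⊕ 𝟘 ≃ a
⊕-identityʳ a = ≃-trans (⊕-comm a 𝟘) (⊕-identityˡ a)

⊖-cong : ∀ {a b} → a ≃ b → ⊖ a ≃ ⊖ b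
⊖-cong {a} {b} p .get m = trans (coeff-⊖ a m) (trans (cong -_ (get p m)) (sym (coeff-⊖ b m)))

⊖-inverseˡ : ∀ a → ⊖ a ⊕ a ≃ 𝟘
⊖-inverseˡ a .get m = begin
  coeff (⊖ a ⊕ a) m              ≡⟨ coeff-⊕ (⊖ a) a m ⟩
  coeff (⊖ a) m + coeff a m      ≡⟨ cong (_+ coeff a m) (coeff-⊖ a m) ⟩
  - coeff a m + coeff a m        ≡⟨ ℤP.+-inverseˡ (coeff a m) ⟩
  ℤ.0ℤ                           ≡⟨ coeff-𝟘 m ⟨
  coeff 𝟘 m                      ∎
  where open ≡-Reasoning

⊖-inverseʳ : ∀ a → a ⊕ ⊖ a ≃ 𝟘
⊖-inverseʳ a = ≃-trans (⊕-comm a (⊖ a)) (⊖-inverseˡ a)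

⊛-comm : ∀ a b → a ⊛ b ≃ b ⊛ a
⊛-comm (e , cs) (f , ds) = ,-cong (ℤP.+-comm e f) (mulL-comm cs ds)

⊛-assoc : ∀ a b c → (a ⊛ b) ⊛ c ≃ a ⊛ (b ⊛ c)
⊛-assoc (e , cs) (f , ds) (g , es) = ,-cong (ℤP.+-assoc e f g) (mulL-assoc cs ds es)

⊛-congˡ : ∀ a {b b′} → b ≃ b′ → a ⊛ b ≃ a ⊛ b′
⊛-congˡ (e , cs) {b} {b′} p = go e cs
  where
  open ≡-Reasoning
  go : ∀ e cs → (e , cs) ⊛ b ≃ (e , cs) ⊛ b′
  go e [] .get m = trans (coeff-[]⊛ e b m) (sym (coeff-[]⊛ e b′ m))
  go e (x ∷ xs) .get m = begin
    coeff ((e , x ∷ xs) ⊛ b) m                            ≡⟨ coeff-∷⊛ e x xs b m ⟩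
    x * coeff b (m - e) + coeff ((e + ℤ.1ℤ , xs) ⊛ b) m   ≡⟨ cong₂ _+_ (cong (x *_) (get p (m - e))) (get (go (e + ℤ.1ℤ) xs) m) ⟩
    x * coeff b′ (m - e) + coeff ((e + ℤ.1ℤ , xs) ⊛ b′) m ≡⟨ coeff-∷⊛ e x xs b′ m ⟨
    coeff ((e , x ∷ xs) ⊛ b′) m                           ∎

⊛-cong : ∀ {a a′ b b′} → a ≃ a′ → b ≃ b′ → a ⊛ b ≃ a′ ⊛ b′
⊛-cong {a} {a′} {b} {b′} p q =
  ≃-trans (⊛-congˡ a q) (≃-trans (⊛-comm a b′) (≃-trans (⊛-congˡ b′ p) (⊛-comm b′ a′)))

⊛-congʳ : ∀ a {b b′} → b ≃ b′ → b ⊛ a ≃ b′ ⊛ a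
⊛-congʳ a b≃b′ = ⊛-cong b≃b′ (≃-refl {a})

⊛-identityˡ : ∀ a → 𝟙 ⊛ a ≃ a
⊛-identityˡ a .get m = begin
  coeff (𝟙 ⊛ a) m                                              ≡⟨ coeff-∷⊛ ℤ.0ℤ ℤ.1ℤ [] a m ⟩
  ℤ.1ℤ * coeff a (m - ℤ.0ℤ) + coeff ((ℤ.1ℤ , []) ⊛ a) m        ≡⟨ cong₂ _+_ (ℤP.*-identityˡ (coeff a (m - ℤ.0ℤ))) (coeff-[]⊛ ℤ.1ℤ a m) ⟩
  coeff a (m - ℤ.0ℤ) + ℤ.0ℤ                                    ≡⟨ ℤP.+-identityʳ (coeff a (m - ℤ.0ℤ)) ⟩
  coeff a (m - ℤ.0ℤ)                                           ≡⟨ cong (coeff a) (ℤP.+-identityʳ m) ⟩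
  coeff a m                                                    ∎
  where open ≡-Reasoning

⊛-identityʳ : ∀ a → a ⊛ 𝟙 ≃ a
⊛-identityʳ a = ≃-trans (⊛-comm a 𝟙) (⊛-identityˡ a)

⊛-distribˡ : ∀ a b c → a ⊛ (b ⊕ c) ≃ a ⊛ b ⊕ a ⊛ c
⊛-distribˡ (e , cs) b c = go e cs
  where
  open ≡-Reasoning
  regroup : ∀ x u v s t → x * (u + v) + (s + t) ≡ (x * u + s) + (x * v + t)
  regroup = solve-∀
  go : ∀ e cs → (e , cs) ⊛ (b ⊕ c) ≃ (e , cs) ⊛ b ⊕ (e , cs) ⊛ c
  go e [] .get m = begin
    coeff ((e , []) ⊛ (b ⊕ c)) m                      ≡⟨ coeff-[]⊛ e (b ⊕ c) m ⟩
    ℤ.0ℤ + ℤ.0ℤ                                        ≡⟨ cong₂ _+_ (coeff-[]⊛ e b m) (coeff-[]⊛ e c m) ⟨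
    coeff ((e , []) ⊛ b) m + coeff ((e , []) ⊛ c) m   ≡⟨ coeff-⊕ ((e , []) ⊛ b) _ m ⟨
    coeff ((e , []) ⊛ b ⊕ (e , []) ⊛ c) m             ∎
  go e (x ∷ xs) .get m = begin
    coeff (a ⊛ (b ⊕ c)) m
      ≡⟨ coeff-∷⊛ e x xs (b ⊕ c) m ⟩
    x * coeff (b ⊕ c) (m - e) + coeff (a′ ⊛ (b ⊕ c)) m
      ≡⟨ cong₂ _+_ (cong (x *_) (coeff-⊕ b c (m - e))) (trans (get (go (e + ℤ.1ℤ) xs) m) (coeff-⊕ (a′ ⊛ b) _ m)) ⟩
    x * (coeff b (m - e) + coeff c (m - e)) + (coeff (a′ ⊛ b) m + coeff (a′ ⊛ c) m)
      ≡⟨ regroup x (coeff b (m - e)) (coeff c (m - e)) _ _ ⟩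
    (x * coeff b (m - e) + coeff (a′ ⊛ b) m) + (x * coeff c (m - e) + coeff (a′ ⊛ c) m)
      ≡⟨ cong₂ _+_ (coeff-∷⊛ e x xs b m) (coeff-∷⊛ e x xs c m) ⟨
    coeff (a ⊛ b) m + coeff (a ⊛ c) m
      ≡⟨ coeff-⊕ (a ⊛ b) _ m ⟨
    coeff (a ⊛ b ⊕ a ⊛ c) m
      ∎
    where
    a = (e , x ∷ xs)
    a′ = (e + ℤ.1ℤ , xs)

⊛-distribʳ : ∀ a b c → (b ⊕ c) ⊛ a ≃ b ⊛ a ⊕ c ⊛ a
⊛-distribʳ a b c =
  ≃-trans (⊛-comm (b ⊕ c) a) (≃-trans (⊛-distribˡ a b c) (⊕-cong (⊛-comm a b) (⊛-comm a c)))

LP-commutativeRing : CommutativeRing _ _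
LP-commutativeRing = record
  { Carrier = LP ; _≈_ = _≃_ ; _+_ = _⊕_ ; _*_ = _⊛_ ; -_ = ⊖_ ; 0# = 𝟘 ; 1# = 𝟙
  ; isCommutativeRing = record
    { isRing = record
      { +-isAbelianGroup = record
        { isGroup = record
          { isMonoid = record
            { isSemigroup = record
              { isMagma = record
                { isEquivalence = record { refl = ≃-refl ; sym = ≃-sym ; trans = ≃-trans }
                ; ∙-cong = ⊕-cong }
              ; assoc = ⊕-assoc }
            ; identity = ⊕-identityˡ , ⊕-identityʳ }
          ; inverse = ⊖-inverseˡ , ⊖-inverseʳ
          ; ⁻¹-cong = ⊖-cong }
        ; comm = ⊕-comm }
      ; *-cong = ⊛-cong
      ; *-assoc = ⊛-assoc
      ; *-identity = ⊛-identityˡ , ⊛-identityʳ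
      ; distrib = ⊛-distribˡ , ⊛-distribʳ }
    ; *-comm = ⊛-comm } }

open CommutativeRing LP-commutativeRing
  using ()
  renaming ( setoid to ≃-setoid
           ; zeroˡ to ⊛-zeroˡ; zeroʳ to ⊛-zeroʳ)

-- The ring solver only identifies coefficients that cancel with the help of a zero test.
≋[]? : ∀ cs → Maybe (cs ≋ [])
≋[]? [] = just ≋-refl
≋[]? (c ∷ cs) with c ℤ.≟ ℤ.0ℤ | ≋[]? cs
... | yes c≡0 | just cs≋[] = just (mk≋ λ { zero → c≡0 ; (suc k) → at cs≋[] k })
... | _ | _ = nothing

𝟘≟_ : ∀ a → Maybe (𝟘 ≃ a)
𝟘≟ (e , cs) = Maybe.map (≃-trans 𝟘≃e,[] ∘ ,-cong refl ∘ ≋-sym) (≋[]? cs)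
  where
  𝟘≃e,[] : 𝟘 ≃ (e , [])
  𝟘≃e,[] .get m = trans (coeff-𝟘 m) (sym (trans (coeff≡lookupZ e [] m) (lookupZ-[] (m - e))))

LP-almostCommutativeRing : ACR.AlmostCommutativeRing _ _
LP-almostCommutativeRing = ACR.fromCommutativeRing LP-commutativeRing 𝟘≟_

open RingSolver using () renaming (solve-∀ to solveLP-∀)

qpow-cong : ∀ {a b} → a ≡ b → qpow a ≃ qpow b
qpow-cong = ≃-reflexive ∘ cong qpow

open import Relation.Binary.Reasoning.Setoid ≃-setoid

-- Finite sums and convolutions

∑≤ : ℕ → (ℕ → LP) → LP
∑≤ zero h = h 0
∑≤ (suc k) h = ∑≤ k h ⊕ h (suc k)

syntax ∑≤ k (λ j → e) = ∑[ j ≤ k ] e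

∑-cong : ∀ k {h h′} → (∀ j → j ℕ.≤ k → h j ≃ h′ j) → ∑≤ k h ≃ ∑≤ k h′
∑-cong zero h≃h′ = h≃h′ 0 z≤n
∑-cong (suc k) h≃h′ = ⊕-cong (∑-cong k (λ j j≤k → h≃h′ j (ℕP.m≤n⇒m≤1+n j≤k))) (h≃h′ (suc k) ℕP.≤-refl)

∑-zero : ∀ k {h} → (∀ j → j ℕ.≤ k → h j ≃ 𝟘) → ∑≤ k h ≃ 𝟘
∑-zero zero h≃𝟘 = h≃𝟘 0 z≤n
∑-zero (suc k) h≃𝟘 =
  ≃-trans (⊕-cong (∑-zero k (λ j j≤k → h≃𝟘 j (ℕP.m≤n⇒m≤1+n j≤k))) (h≃𝟘 (suc k) ℕP.≤-refl)) (⊕-identityˡ 𝟘)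

∑-⊕ : ∀ k h h′ → ∑[ j ≤ k ] (h j ⊕ h′ j) ≃ ∑≤ k h ⊕ ∑≤ k h′
∑-⊕ zero h h′ = ≃-refl
∑-⊕ (suc k) h h′ = ≃-trans (⊕-congʳ _ (∑-⊕ k h h′)) (interchange _ _ _ _)
  where
  interchange : ∀ a b c d → (a ⊕ b) ⊕ (c ⊕ d) ≃ (a ⊕ c) ⊕ (b ⊕ d)
  interchange = solveLP-∀ LP-almostCommutativeRing

⊛-distribˡ-∑ : ∀ k c h → c ⊛ ∑≤ k h ≃ ∑[ j ≤ k ] (c ⊛ h j)
⊛-distribˡ-∑ zero c h = ≃-refl
⊛-distribˡ-∑ (suc k) c h = ≃-trans (⊛-distribˡ c _ _) (⊕-congʳ _ (⊛-distribˡ-∑ k c h))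

∑-split-first : ∀ k h → ∑≤ (suc k) h ≃ h 0 ⊕ ∑[ j ≤ k ] h (suc j)
∑-split-first zero h = ≃-refl
∑-split-first (suc k) h = ≃-trans (⊕-congʳ _ (∑-split-first k h)) (⊕-assoc _ _ _)

-- `conv` sums through a local function `go` that is out of scope here; the
-- metavariable `conv-go` is solved to it by unifying against `conv-go-unfold`.
mutual
  conv-go : (ℕ → LP) → (ℕ → LP) → ℕ → ℕ → LP
  conv-go = _

  conv-go-unfold : ∀ f g k → conv f g (suc k) ≡ conv-go f g (suc k) k ⊕ f (suc k) ⊛ g (k ∸ k)
  conv-go-unfold f g k with suc k
  ... | i = refl

conv-go≡∑ : ∀ f g i k → conv-go f g i k ≡ ∑[ j ≤ k ] (f j ⊛ g (i ∸ j))
conv-go≡∑ f g i zero = refl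
conv-go≡∑ f g i (suc k) = cong (_⊕ f (suc k) ⊛ g (i ∸ suc k)) (conv-go≡∑ f g i k)

conv≡∑ : ∀ f g i → conv f g i ≡ ∑[ j ≤ i ] (f j ⊛ g (i ∸ j))
conv≡∑ f g i = conv-go≡∑ f g i i

conv-linearˡ : ∀ a b h k → conv (fromList (a ∷ b ∷ [])) h (suc k) ≃ a ⊛ h (suc k) ⊕ b ⊛ h k
conv-linearˡ a b h k = begin
  conv F h (suc k)                               ≡⟨ conv≡∑ F h (suc k) ⟩
  ∑[ j ≤ suc k ] (F j ⊛ h (suc k ∸ j))           ≈⟨ ∑-split-first k _ ⟩
  a ⊛ h (suc k) ⊕ ∑[ j ≤ k ] (F (suc j) ⊛ h (k ∸ j))  ≈⟨ ⊕-congˡ _ (tail k) ⟩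
  a ⊛ h (suc k) ⊕ b ⊛ h k                        ∎
  where
  F = fromList (a ∷ b ∷ [])
  tail : ∀ k → ∑[ j ≤ k ] (F (suc j) ⊛ h (k ∸ j)) ≃ b ⊛ h k
  tail zero = ≃-refl
  tail (suc k) = ≃-trans (∑-split-first k _)
    (≃-trans (⊕-congˡ _ (∑-zero k (λ j _ → ⊛-zeroˡ (h (suc k ∸ suc j))))) (⊕-identityʳ _))

conv-constʳ : ∀ h c i → conv h (fromList (c ∷ [])) i ≃ h i ⊛ c
conv-constʳ h c zero = ≃-refl
conv-constʳ h c (suc k) = begin
  conv h γ (suc k)                                   ≡⟨ conv≡∑ h γ (suc k) ⟩
  ∑[ j ≤ k ] (h j ⊛ γ (suc k ∸ j)) ⊕ h (suc k) ⊛ γ (k ∸ k)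
    ≈⟨ ⊕-cong (∑-zero k λ j j≤k → ≃-trans (≃-reflexive (cong (λ t → h j ⊛ γ t) (ℕP.+-∸-assoc 1 j≤k)))
                                          (⊛-zeroʳ (h j)))
              (≃-reflexive (cong (λ t → h (suc k) ⊛ γ t) (ℕP.n∸n≡0 k))) ⟩
  𝟘 ⊕ h (suc k) ⊛ c                                  ≈⟨ ⊕-identityˡ _ ⟩
  h (suc k) ⊛ c                                      ∎
  where
  γ = fromList (c ∷ [])

conv-scaleˡ : ∀ {f} g c p r → (∀ j → f j ≃ c ⊛ p j) → conv f g r ≃ c ⊛ conv p g r
conv-scaleˡ {f} g c p r f≃cp = begin
  conv f g r
    ≡⟨ conv≡∑ f g r ⟩
  ∑[ j ≤ r ] (f j ⊛ g (r ∸ j))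
    ≈⟨ ∑-cong r (λ j _ → ≃-trans (⊛-congʳ (g (r ∸ j)) (f≃cp j)) (⊛-assoc c (p j) (g (r ∸ j)))) ⟩
  ∑[ j ≤ r ] (c ⊛ (p j ⊛ g (r ∸ j)))
    ≈⟨ ⊛-distribˡ-∑ r c _ ⟨
  c ⊛ ∑[ j ≤ r ] (p j ⊛ g (r ∸ j))
    ≡⟨ cong (c ⊛_) (conv≡∑ p g r) ⟨
  c ⊛ conv p g r
    ∎

conv-pascalˡ : ∀ {f′} f g r → f′ 0 ≃ f 0 → (∀ j → f′ (suc j) ≃ f (suc j) ⊕ f j) →
  conv f′ g (suc r) ≃ conv f g (suc r) ⊕ conv f g r
conv-pascalˡ {f′} f g r f′0≃f0 pascal = begin
  conv f′ g (suc r)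
    ≡⟨ conv≡∑ f′ g (suc r) ⟩
  ∑[ j ≤ suc r ] (f′ j ⊛ g (suc r ∸ j))
    ≈⟨ ∑-split-first r _ ⟩
  f′ 0 ⊛ g (suc r) ⊕ ∑[ j ≤ r ] (f′ (suc j) ⊛ g (r ∸ j))
    ≈⟨ ⊕-cong (⊛-congʳ (g (suc r)) f′0≃f0)
              (∑-cong r λ j _ → ≃-trans (⊛-congʳ (g (r ∸ j)) (pascal j)) (⊛-distribʳ (g (r ∸ j)) (f (suc j)) (f j))) ⟩
  f 0 ⊛ g (suc r) ⊕ ∑[ j ≤ r ] (f (suc j) ⊛ g (r ∸ j) ⊕ f j ⊛ g (r ∸ j))
    ≈⟨ ⊕-congˡ (f 0 ⊛ g (suc r)) (∑-⊕ r _ _) ⟩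
  f 0 ⊛ g (suc r) ⊕ (∑[ j ≤ r ] (f (suc j) ⊛ g (r ∸ j)) ⊕ ∑[ j ≤ r ] (f j ⊛ g (r ∸ j)))
    ≈⟨ ⊕-assoc (f 0 ⊛ g (suc r)) _ _ ⟨
  (f 0 ⊛ g (suc r) ⊕ ∑[ j ≤ r ] (f (suc j) ⊛ g (r ∸ j))) ⊕ ∑[ j ≤ r ] (f j ⊛ g (r ∸ j))
    ≈⟨ ⊕-congʳ _ (∑-split-first r _) ⟨
  ∑[ j ≤ suc r ] (f j ⊛ g (suc r ∸ j)) ⊕ ∑[ j ≤ r ] (f j ⊛ g (r ∸ j))
    ≡⟨ cong₂ _⊕_ (conv≡∑ f g (suc r)) (conv≡∑ f g r) ⟨
  conv f g (suc r) ⊕ conv f g r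
    ∎

conv-split-last : ∀ f g r → conv f g (suc r) ≃ ∑[ j ≤ r ] (f j ⊛ g (suc (r ∸ j))) ⊕ f (suc r) ⊛ g 0
conv-split-last f g r = begin
  conv f g (suc r)                                                   ≡⟨ conv≡∑ f g (suc r) ⟩
  ∑[ j ≤ r ] (f j ⊛ g (suc r ∸ j)) ⊕ f (suc r) ⊛ g (r ∸ r)
    ≈⟨ ⊕-cong (∑-cong r λ j j≤r → ≃-reflexive (cong (λ k → f j ⊛ g k) (ℕP.+-∸-assoc 1 j≤r)))
              (≃-reflexive (cong (λ k → f (suc r) ⊛ g k) (ℕP.n∸n≡0 r))) ⟩
  ∑[ j ≤ r ] (f j ⊛ g (suc (r ∸ j))) ⊕ f (suc r) ⊛ g 0               ∎

conv-recurrenceʳ : ∀ f {g g′ g″} c r → (∀ k → g (suc k) ⊕ g k ≃ g′ (suc k) ⊕ c ⊛ g″ k) →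
  conv f g (suc r) ⊕ conv f g r ≃ (conv f g′ (suc r) ⊕ c ⊛ conv f g″ r) ⊕ f (suc r) ⊛ (g 0 ⊕ ⊖ g′ 0)
conv-recurrenceʳ f {g} {g′} {g″} c r recurrence = begin
  conv f g (suc r) ⊕ conv f g r
    ≈⟨ ⊕-cong (conv-split-last f g r) (≃-reflexive (conv≡∑ f g r)) ⟩
  (∑[ j ≤ r ] (f j ⊛ g (suc (r ∸ j))) ⊕ f (suc r) ⊛ g 0) ⊕ ∑[ j ≤ r ] (f j ⊛ g (r ∸ j))
    ≈⟨ ≃-trans (swap₂₃ _ _ _) (⊕-congʳ _ (≃-sym (∑-⊕ r _ _))) ⟩
  ∑[ j ≤ r ] (f j ⊛ g (suc (r ∸ j)) ⊕ f j ⊛ g (r ∸ j)) ⊕ f (suc r) ⊛ g 0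
    ≈⟨ ⊕-congʳ _ (∑-cong r λ j _ → use-recurrence (f j) (recurrence (r ∸ j))) ⟩
  ∑[ j ≤ r ] (f j ⊛ g′ (suc (r ∸ j)) ⊕ c ⊛ (f j ⊛ g″ (r ∸ j))) ⊕ f (suc r) ⊛ g 0
    ≈⟨ ⊕-congʳ _ (≃-trans (∑-⊕ r _ _) (⊕-congˡ _ (≃-sym (⊛-distribˡ-∑ r c _)))) ⟩
  (∑[ j ≤ r ] (f j ⊛ g′ (suc (r ∸ j))) ⊕ c ⊛ ∑[ j ≤ r ] (f j ⊛ g″ (r ∸ j))) ⊕ f (suc r) ⊛ g 0
    ≈⟨ boundary _ _ (f (suc r)) (g 0) (g′ 0) ⟩
  ((∑[ j ≤ r ] (f j ⊛ g′ (suc (r ∸ j))) ⊕ f (suc r) ⊛ g′ 0) ⊕ c ⊛ ∑[ j ≤ r ] (f j ⊛ g″ (r ∸ j)))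
    ⊕ f (suc r) ⊛ (g 0 ⊕ ⊖ g′ 0)
    ≈⟨ ⊕-congʳ _ (⊕-cong (conv-split-last f g′ r) (⊛-congˡ c (≃-reflexive (conv≡∑ f g″ r)))) ⟨
  (conv f g′ (suc r) ⊕ c ⊛ conv f g″ r) ⊕ f (suc r) ⊛ (g 0 ⊕ ⊖ g′ 0)
    ∎
  where
  swap₂₃ : ∀ a b c → (a ⊕ b) ⊕ c ≃ (a ⊕ c) ⊕ b
  swap₂₃ = solveLP-∀ LP-almostCommutativeRing
  use-recurrence : ∀ p {x y z w} → x ⊕ y ≃ z ⊕ c ⊛ w → p ⊛ x ⊕ p ⊛ y ≃ p ⊛ z ⊕ c ⊛ (p ⊛ w)
  use-recurrence p {x} {y} {z} {w} eq = begin
    p ⊛ x ⊕ p ⊛ y      ≈⟨ ⊛-distribˡ p x y ⟨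
    p ⊛ (x ⊕ y)        ≈⟨ ⊛-congˡ p eq ⟩
    p ⊛ (z ⊕ c ⊛ w)    ≈⟨ regroup p z c w ⟩
    p ⊛ z ⊕ c ⊛ (p ⊛ w) ∎
    where
    regroup : ∀ p z c w → p ⊛ (z ⊕ c ⊛ w) ≃ p ⊛ z ⊕ c ⊛ (p ⊛ w)
    regroup = solveLP-∀ LP-almostCommutativeRing
  boundary : ∀ s u p x y → (s ⊕ u) ⊕ p ⊛ x ≃ ((s ⊕ p ⊛ y) ⊕ u) ⊕ p ⊛ (x ⊕ ⊖ y)
  boundary = solveLP-∀ LP-almostCommutativeRing

-- Binomial and q-binomial coefficients

fromℕ : ℕ → LP
fromℕ c = (ℤ.0ℤ , + c ∷ [])

binomial : ℕ → ℕ → LP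
binomial n = proj₂ (powW onePlusW n)

binomial-zero : ∀ n → binomial n 0 ≃ 𝟙
binomial-zero zero = ≃-refl
binomial-zero (suc n) = ≃-trans (⊛-identityˡ _) (binomial-zero n)

binomial-pascal : ∀ n k → binomial (suc n) (suc k) ≃ binomial n (suc k) ⊕ binomial n k
binomial-pascal n k =
  ≃-trans (conv-linearˡ 𝟙 𝟙 (binomial n) k) (⊕-cong (⊛-identityˡ _) (⊛-identityˡ _))

binomial≃C : ∀ n k → binomial n k ≃ fromℕ (n C k)
binomial≃C zero zero = ≃-refl
binomial≃C zero (suc k) = ,-cong refl (mk≋ λ { zero → refl ; (suc _) → refl })
binomial≃C (suc n) zero = binomial-zero (suc n)
binomial≃C (suc n) (suc k) = begin
  binomial (suc n) (suc k)                  ≈⟨ binomial-pascal n k ⟩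
  binomial n (suc k) ⊕ binomial n k         ≈⟨ ⊕-cong (binomial≃C n (suc k)) (binomial≃C n k) ⟩
  fromℕ (n C suc k ℕ.+ n C k)               ≡⟨ cong fromℕ (trans (ℕP.+-comm (n C suc k) _) (nCk+nC[k+1]≡[n+1]C[k+1] n k)) ⟩
  fromℕ (suc n C suc k)                     ∎

binomialDiff : ℕ → ℕ → LP
binomialDiff n = proj₂ (oneMinusW ⊗ powW onePlusW n)

binomialDiff-zero : ∀ n → binomialDiff n 0 ≃ 𝟙
binomialDiff-zero n = ≃-trans (⊛-identityˡ _) (binomial-zero n)

binomialDiff-suc : ∀ n k → binomialDiff n (suc k) ≃ binomial n (suc k) ⊕ ⊖ binomial n k
binomialDiff-suc n k = ≃-trans (conv-linearˡ 𝟙 (⊖ 𝟙) (binomial n) k) (unit _ _)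
  where
  unit : ∀ a b → 𝟙 ⊛ a ⊕ ⊖ 𝟙 ⊛ b ≃ a ⊕ ⊖ b
  unit = solveLP-∀ LP-almostCommutativeRing

binomialDiff-pascal : ∀ n k → binomialDiff (suc n) (suc k) ≃ binomialDiff n (suc k) ⊕ binomialDiff n k
binomialDiff-pascal n zero = begin
  binomialDiff (suc n) 1                              ≈⟨ binomialDiff-suc (suc n) 0 ⟩
  binomial (suc n) 1 ⊕ ⊖ binomial (suc n) 0           ≈⟨ ⊕-cong (binomial-pascal n 0) (⊖-cong (binomial-zero (suc n))) ⟩
  (binomial n 1 ⊕ binomial n 0) ⊕ ⊖ 𝟙                 ≈⟨ ⊕-congʳ _ (⊕-congˡ _ (binomial-zero n)) ⟩
  (binomial n 1 ⊕ 𝟙) ⊕ ⊖ 𝟙                            ≈⟨ regroup (binomial n 1) ⟩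
  (binomial n 1 ⊕ ⊖ 𝟙) ⊕ 𝟙                            ≈⟨ ⊕-cong (⊕-congˡ _ (⊖-cong (binomial-zero n))) (binomialDiff-zero n) ⟨
  (binomial n 1 ⊕ ⊖ binomial n 0) ⊕ binomialDiff n 0  ≈⟨ ⊕-congʳ _ (binomialDiff-suc n 0) ⟨
  binomialDiff n 1 ⊕ binomialDiff n 0                 ∎
  where
  regroup : ∀ a → (a ⊕ 𝟙) ⊕ ⊖ 𝟙 ≃ (a ⊕ ⊖ 𝟙) ⊕ 𝟙
  regroup = solveLP-∀ LP-almostCommutativeRing
binomialDiff-pascal n (suc k) = begin
  binomialDiff (suc n) (suc (suc k))
    ≈⟨ binomialDiff-suc (suc n) (suc k) ⟩
  binomial (suc n) (suc (suc k)) ⊕ ⊖ binomial (suc n) (suc k)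
    ≈⟨ ⊕-cong (binomial-pascal n (suc k)) (⊖-cong (binomial-pascal n k)) ⟩
  (binomial n (suc (suc k)) ⊕ binomial n (suc k)) ⊕ ⊖ (binomial n (suc k) ⊕ binomial n k)
    ≈⟨ regroup _ _ _ ⟩
  (binomial n (suc (suc k)) ⊕ ⊖ binomial n (suc k)) ⊕ (binomial n (suc k) ⊕ ⊖ binomial n k)
    ≈⟨ ⊕-cong (binomialDiff-suc n (suc k)) (binomialDiff-suc n k) ⟨
  binomialDiff n (suc (suc k)) ⊕ binomialDiff n (suc k)
    ∎
  where
  regroup : ∀ a b c → (a ⊕ b) ⊕ ⊖ (b ⊕ c) ≃ (a ⊕ ⊖ b) ⊕ (b ⊕ ⊖ c)
  regroup = solveLP-∀ LP-almostCommutativeRing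

binomialDiff-middle : ∀ r → binomialDiff (suc (2 ℕ.* r)) (suc r) ≃ 𝟘
binomialDiff-middle r = begin
  binomialDiff n (suc r)                   ≈⟨ binomialDiff-suc n r ⟩
  binomial n (suc r) ⊕ ⊖ binomial n r      ≈⟨ ⊕-cong (binomial≃C n (suc r)) (⊖-cong (binomial≃C n r)) ⟩
  fromℕ (n C suc r) ⊕ ⊖ fromℕ (n C r)      ≡⟨ cong (λ c → fromℕ (n C suc r) ⊕ ⊖ fromℕ c) C-symmetric ⟩
  fromℕ (n C suc r) ⊕ ⊖ fromℕ (n C suc r)  ≈⟨ ⊖-inverseʳ (fromℕ (n C suc r)) ⟩
  𝟘                                        ∎
  where
  n = suc (2 ℕ.* r)
  n∸r≡1+r : n ∸ r ≡ suc r
  n∸r≡1+r = trans (cong (λ t → suc (r ℕ.+ t) ∸ r) (ℕP.+-identityʳ r)) (ℕP.m+n∸n≡m (suc r) r)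
  C-symmetric : n C r ≡ n C suc r
  C-symmetric = trans (nCk≡nC[n∸k] (ℕP.m≤n⇒m≤1+n (ℕP.m≤m+n r _))) (cong (n C_) n∸r≡1+r)

qbinom-zero : ∀ M k → M ℕ.< k → qbinom M k ≃ 𝟘
qbinom-zero zero (suc k) _ = ≃-refl
qbinom-zero (suc M) (suc k) (s≤s M<k) = begin
  qbinom M k ⊕ qpow (+ suc k) ⊛ qbinom M (suc k)
    ≈⟨ ⊕-cong (qbinom-zero M k M<k) (⊛-congˡ (qpow (+ suc k)) (qbinom-zero M (suc k) (ℕP.m≤n⇒m≤1+n M<k))) ⟩
  𝟘 ⊕ qpow (+ suc k) ⊛ 𝟘
    ≈⟨ ≃-trans (⊕-identityˡ _) (⊛-zeroʳ (qpow (+ suc k))) ⟩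
  𝟘 ∎

qbinom-diag : ∀ m → qbinom m m ≃ 𝟙
qbinom-diag zero = ≃-refl
qbinom-diag (suc m) = begin
  qbinom m m ⊕ qpow (+ suc m) ⊛ qbinom m (suc m)
    ≈⟨ ⊕-cong (qbinom-diag m) (⊛-congˡ (qpow (+ suc m)) (qbinom-zero m (suc m) ℕP.≤-refl)) ⟩
  𝟙 ⊕ qpow (+ suc m) ⊛ 𝟘
    ≈⟨ ≃-trans (⊕-congˡ 𝟙 (⊛-zeroʳ (qpow (+ suc m)))) (⊕-identityʳ 𝟙) ⟩
  𝟙 ∎

qbinomℤ-zero : ∀ z k → z ℤ.< + k → qbinomℤ z k ≃ 𝟘
qbinomℤ-zero (+ M) k (ℤ.+<+ M<k) = qbinom-zero M k M<k
qbinomℤ-zero -[1+ _ ] k _ = ≃-refl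

mutual
  qbinom-raise : ∀ i d →
    (qpow (+ suc (i ℕ.+ d)) ⊕ ⊖ 𝟙) ⊛ qbinom (i ℕ.+ d) i ≃ (qpow (+ suc d) ⊕ ⊖ 𝟙) ⊛ qbinom (suc (i ℕ.+ d)) i
  qbinom-raise zero d = ≃-refl
  qbinom-raise (suc i) d = ≃-sym (begin
    (v ⊕ ⊖ 𝟙) ⊛ (qbinom (suc (i ℕ.+ d)) i ⊕ u ⊛ qbinom (suc (i ℕ.+ d)) (suc i))
      ≈⟨ distrib v u (qbinom (suc (i ℕ.+ d)) i) (qbinom (suc (i ℕ.+ d)) (suc i)) ⟩
    (v ⊕ ⊖ 𝟙) ⊛ qbinom (suc (i ℕ.+ d)) i ⊕ ((v ⊕ ⊖ 𝟙) ⊛ u) ⊛ qbinom (suc (i ℕ.+ d)) (suc i)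
      ≈⟨ ⊕-congʳ _ (≃-trans (≃-sym (qbinom-raise i d)) (≃-sym (qbinom-absorb i d))) ⟩
    (u ⊕ ⊖ 𝟙) ⊛ qbinom (suc (i ℕ.+ d)) (suc i) ⊕ ((v ⊕ ⊖ 𝟙) ⊛ u) ⊛ qbinom (suc (i ℕ.+ d)) (suc i)
      ≈⟨ collect v u (qbinom (suc (i ℕ.+ d)) (suc i)) ⟩
    (v ⊛ u ⊕ ⊖ 𝟙) ⊛ qbinom (suc (i ℕ.+ d)) (suc i)
      ≈⟨ ⊛-congʳ (qbinom (suc (i ℕ.+ d)) (suc i)) (⊕-congʳ (⊖ 𝟙) (qpow-cong (cong +_ (exponent i d)))) ⟩
    (qpow (+ suc (suc i ℕ.+ d)) ⊕ ⊖ 𝟙) ⊛ qbinom (suc i ℕ.+ d) (suc i)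
      ∎)
    where
    u = qpow (+ suc i)
    v = qpow (+ suc d)
    distrib : ∀ v u X Y → (v ⊕ ⊖ 𝟙) ⊛ (X ⊕ u ⊛ Y) ≃ (v ⊕ ⊖ 𝟙) ⊛ X ⊕ ((v ⊕ ⊖ 𝟙) ⊛ u) ⊛ Y
    distrib = solveLP-∀ LP-almostCommutativeRing
    collect : ∀ v u Y → (u ⊕ ⊖ 𝟙) ⊛ Y ⊕ ((v ⊕ ⊖ 𝟙) ⊛ u) ⊛ Y ≃ (v ⊛ u ⊕ ⊖ 𝟙) ⊛ Y
    collect = solveLP-∀ LP-almostCommutativeRing
    exponent : ∀ i d → suc d ℕ.+ suc i ≡ suc (suc i ℕ.+ d)
    exponent = ℕ-Solver.solve-∀

  qbinom-absorb : ∀ i d →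
    (qpow (+ suc i) ⊕ ⊖ 𝟙) ⊛ qbinom (suc (i ℕ.+ d)) (suc i) ≃ (qpow (+ suc (i ℕ.+ d)) ⊕ ⊖ 𝟙) ⊛ qbinom (i ℕ.+ d) i
  qbinom-absorb i zero = ⊛-cong (⊕-congʳ (⊖ 𝟙) (qpow-cong (cong (λ t → + suc t) (sym (ℕP.+-identityʳ i)))))
    (≃-trans (qbinom-diag′ (suc i)) (≃-sym (qbinom-diag′ i)))
    where
    qbinom-diag′ : ∀ m → qbinom (m ℕ.+ 0) m ≃ 𝟙
    qbinom-diag′ m = ≃-trans (≃-reflexive (cong (λ M → qbinom M m) (ℕP.+-identityʳ m))) (qbinom-diag m)
  qbinom-absorb i (suc d) = begin
    (u ⊕ ⊖ 𝟙) ⊛ (qbinom (i ℕ.+ suc d) i ⊕ u ⊛ qbinom (i ℕ.+ suc d) (suc i))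
      ≈⟨ ⊛-congˡ (u ⊕ ⊖ 𝟙) (⊕-congˡ _ (⊛-congˡ u (qbinom-top (suc i)))) ⟩
    (u ⊕ ⊖ 𝟙) ⊛ (qbinom (i ℕ.+ suc d) i ⊕ u ⊛ qbinom (suc (i ℕ.+ d)) (suc i))
      ≈⟨ distrib u (qbinom (i ℕ.+ suc d) i) (qbinom (suc (i ℕ.+ d)) (suc i)) ⟩
    (u ⊕ ⊖ 𝟙) ⊛ qbinom (i ℕ.+ suc d) i ⊕ u ⊛ ((u ⊕ ⊖ 𝟙) ⊛ qbinom (suc (i ℕ.+ d)) (suc i))
      ≈⟨ ⊕-congˡ _ (⊛-congˡ u (≃-trans (qbinom-absorb i d) (qbinom-raise i d))) ⟩
    (u ⊕ ⊖ 𝟙) ⊛ qbinom (i ℕ.+ suc d) i ⊕ u ⊛ ((v ⊕ ⊖ 𝟙) ⊛ qbinom (suc (i ℕ.+ d)) i)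
      ≈⟨ ⊕-congˡ _ (⊛-congˡ u (⊛-congˡ (v ⊕ ⊖ 𝟙) (qbinom-top i))) ⟨
    (u ⊕ ⊖ 𝟙) ⊛ qbinom (i ℕ.+ suc d) i ⊕ u ⊛ ((v ⊕ ⊖ 𝟙) ⊛ qbinom (i ℕ.+ suc d) i)
      ≈⟨ collect u v (qbinom (i ℕ.+ suc d) i) ⟩
    (qpow (+ suc (i ℕ.+ suc d)) ⊕ ⊖ 𝟙) ⊛ qbinom (i ℕ.+ suc d) i
      ∎
    where
    u = qpow (+ suc i)
    v = qpow (+ suc d)
    qbinom-top : ∀ k → qbinom (i ℕ.+ suc d) k ≃ qbinom (suc (i ℕ.+ d)) k
    qbinom-top k = ≃-reflexive (cong (λ M → qbinom M k) (ℕP.+-suc i d))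
    distrib : ∀ u X Y → (u ⊕ ⊖ 𝟙) ⊛ (X ⊕ u ⊛ Y) ≃ (u ⊕ ⊖ 𝟙) ⊛ X ⊕ u ⊛ ((u ⊕ ⊖ 𝟙) ⊛ Y)
    distrib = solveLP-∀ LP-almostCommutativeRing
    collect : ∀ u v Y → (u ⊕ ⊖ 𝟙) ⊛ Y ⊕ u ⊛ ((v ⊕ ⊖ 𝟙) ⊛ Y) ≃ (u ⊛ v ⊕ ⊖ 𝟙) ⊛ Y
    collect = solveLP-∀ LP-almostCommutativeRing

-- The coefficients of the series

triangular : ℕ → ℕ
triangular i = (suc i ℕ.* i) ℕ./ 2

termExp : ℤ → ℕ → ℤ
termExp D i = - (+ triangular i) - + i * D

term : ℤ → ℕ → LP
term D i = sgn i ⊛ qpow (termExp D i) ⊛ qbinomℤ (+ i + D) i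

triangular-suc : ∀ i → triangular (suc i) ≡ triangular i ℕ.+ suc i
triangular-suc i = trans (cong (ℕ._/ 2) expand)
  (trans (+-distrib-/-∣ʳ (suc i ℕ.* i) (divides (suc i) refl)) (cong (triangular i ℕ.+_) (m*n/n≡m (suc i) 2)))
  where
  expand : suc (suc i) ℕ.* suc i ≡ suc i ℕ.* i ℕ.+ suc i ℕ.* 2
  expand = ℕ-Solver.solve (i ∷ [])

termExp-suc : ∀ D i → termExp D (suc i) ≡ termExp (D + ℤ.1ℤ) i - (D + ℤ.1ℤ)
termExp-suc D i = trans (cong (λ t → - (+ t) - + suc i * D) (triangular-suc i)) (rearrange (+ triangular i) (+ i) D)
  where
  rearrange : ∀ t a D → - (t + (ℤ.1ℤ + a)) - (ℤ.1ℤ + a) * D ≡ (- t - a * (D + ℤ.1ℤ)) - (D + ℤ.1ℤ)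
  rearrange = solve-∀

termExp-pred-suc : ∀ D i → termExp (D - ℤ.1ℤ) (suc i) ≡ termExp (D + ℤ.1ℤ) i - (D + ℤ.1ℤ) + + suc i
termExp-pred-suc D i = trans (cong (λ t → - (+ t) - + suc i * (D - ℤ.1ℤ)) (triangular-suc i)) (rearrange (+ triangular i) (+ i) D)
  where
  rearrange : ∀ t a D →
    - (t + (ℤ.1ℤ + a)) - (ℤ.1ℤ + a) * (D - ℤ.1ℤ) ≡ (- t - a * (D + ℤ.1ℤ)) - (D + ℤ.1ℤ) + (ℤ.1ℤ + a)
  rearrange = solve-∀

termExp-pred : ∀ D i → termExp D i ≡ termExp (D + ℤ.1ℤ) i + + i
termExp-pred D i = rearrange (+ triangular i) (+ i) D
  where
  rearrange : ∀ t a D → - t - a * D ≡ (- t - a * (D + ℤ.1ℤ)) + a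
  rearrange = solve-∀

term-vanish : ∀ D j → D ℤ.< ℤ.0ℤ → term D j ≃ 𝟘
term-vanish D j D<0 = ≃-trans (⊛-congˡ (sgn j ⊛ qpow (termExp D j)) (qbinomℤ-zero (+ j + D) j j+D<j))
                              (⊛-zeroʳ (sgn j ⊛ qpow (termExp D j)))
  where
  j+D<j : + j + D ℤ.< + j
  j+D<j = subst (+ j + D ℤ.<_) (ℤP.+-identityʳ (+ j)) (ℤP.+-monoʳ-< (+ j) D<0)

term-zero-pred : ∀ D → D ≢ ℤ.0ℤ → term D 0 ≃ term (D - ℤ.1ℤ) 0
term-zero-pred (+ zero) D≢0 = ⊥-elim (D≢0 refl)
term-zero-pred (+ suc d) _ = ≃-refl
term-zero-pred -[1+ t ] _ = ≃-refl

term-nonneg-zero : ∀ m → term (+ m) 0 ≃ 𝟙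
term-nonneg-zero m = ≃-refl

qbinom-raise-scaled : ∀ i d → let y = qpow (- (+ d + ℤ.1ℤ)) in
  (qpow (+ i) ⊕ ⊖ y) ⊛ qbinom (i ℕ.+ d) i ≃ (𝟙 ⊕ ⊖ y) ⊛ qbinom (suc (i ℕ.+ d)) i
qbinom-raise-scaled i d = begin
  (qpow (+ i) ⊕ ⊖ y) ⊛ qbinom (i ℕ.+ d) i
    ≈⟨ ⊛-congʳ _ (⊕-congʳ (⊖ y) (qpow-cong (sym (cancel₁ (+ i) (+ d))))) ⟩
  (y ⊛ qpow (+ suc (i ℕ.+ d)) ⊕ ⊖ y) ⊛ qbinom (i ℕ.+ d) i
    ≈⟨ factor y (qpow (+ suc (i ℕ.+ d))) (qbinom (i ℕ.+ d) i) ⟩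
  y ⊛ ((qpow (+ suc (i ℕ.+ d)) ⊕ ⊖ 𝟙) ⊛ qbinom (i ℕ.+ d) i)
    ≈⟨ ⊛-congˡ y (qbinom-raise i d) ⟩
  y ⊛ ((qpow (+ suc d) ⊕ ⊖ 𝟙) ⊛ qbinom (suc (i ℕ.+ d)) i)
    ≈⟨ factor y (qpow (+ suc d)) (qbinom (suc (i ℕ.+ d)) i) ⟨
  (y ⊛ qpow (+ suc d) ⊕ ⊖ y) ⊛ qbinom (suc (i ℕ.+ d)) i
    ≈⟨ ⊛-congʳ _ (⊕-congʳ (⊖ y) (qpow-cong (cancel₂ (+ d)))) ⟩
  (𝟙 ⊕ ⊖ y) ⊛ qbinom (suc (i ℕ.+ d)) i
    ∎
  where
  y = qpow (- (+ d + ℤ.1ℤ))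
  cancel₁ : ∀ a b → - (b + ℤ.1ℤ) + (ℤ.1ℤ + (a + b)) ≡ a
  cancel₁ = solve-∀
  cancel₂ : ∀ b → - (b + ℤ.1ℤ) + (ℤ.1ℤ + b) ≡ ℤ.0ℤ
  cancel₂ = solve-∀
  factor : ∀ y u g → (y ⊛ u ⊕ ⊖ y) ⊛ g ≃ y ⊛ ((u ⊕ ⊖ 𝟙) ⊛ g)
  factor = solveLP-∀ LP-almostCommutativeRing

term-recurrence-nonneg : ∀ d i → let D = + d in
  term D (suc i) ⊕ term D i ≃ term (D - ℤ.1ℤ) (suc i) ⊕ (𝟙 ⊕ ⊖ qpow (- (D + ℤ.1ℤ))) ⊛ term (D + ℤ.1ℤ) i
term-recurrence-nonneg d i = begin
  term D (suc i) ⊕ term D i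
    ≈⟨ ⊕-cong T[D,1+i] T[D,i] ⟩
  (⊖ s ⊛ (b ⊛ y)) ⊛ (g₀ ⊕ v ⊛ g₁) ⊕ (s ⊛ (b ⊛ X)) ⊛ g₀
    ≈⟨ regroup s b y v X g₀ g₁ ⟩
  (⊖ s ⊛ ((b ⊛ y) ⊛ v)) ⊛ g₁ ⊕ (s ⊛ b) ⊛ ((X ⊕ ⊖ y) ⊛ g₀)
    ≈⟨ ⊕-congˡ _ (⊛-congˡ (s ⊛ b) (qbinom-raise-scaled i d)) ⟩
  (⊖ s ⊛ ((b ⊛ y) ⊛ v)) ⊛ g₁ ⊕ (s ⊛ b) ⊛ ((𝟙 ⊕ ⊖ y) ⊛ g₂)
    ≈⟨ ⊕-congˡ _ (commute (s ⊛ b) (𝟙 ⊕ ⊖ y) g₂) ⟩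
  (⊖ s ⊛ ((b ⊛ y) ⊛ v)) ⊛ g₁ ⊕ (𝟙 ⊕ ⊖ y) ⊛ ((s ⊛ b) ⊛ g₂)
    ≈⟨ ⊕-cong T[D-1,1+i] (⊛-congˡ (𝟙 ⊕ ⊖ y) T[D+1,i]) ⟨
  term (D - ℤ.1ℤ) (suc i) ⊕ (𝟙 ⊕ ⊖ y) ⊛ term (D + ℤ.1ℤ) i
    ∎
  where
  D = + d
  s = sgn i
  b = qpow (termExp (D + ℤ.1ℤ) i)
  y = qpow (- (D + ℤ.1ℤ))
  X = qpow (+ i)
  v = qpow (+ suc i)
  g₀ = qbinom (i ℕ.+ d) i
  g₁ = qbinom (i ℕ.+ d) (suc i)
  g₂ = qbinom (suc (i ℕ.+ d)) i
  T[D,1+i] : term D (suc i) ≃ (⊖ s ⊛ (b ⊛ y)) ⊛ (g₀ ⊕ v ⊛ g₁)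
  T[D,1+i] = ⊛-congʳ _ (⊛-congˡ (⊖ s) (qpow-cong (termExp-suc D i)))
  T[D,i] : term D i ≃ (s ⊛ (b ⊛ X)) ⊛ g₀
  T[D,i] = ⊛-congʳ _ (⊛-congˡ s (qpow-cong (termExp-pred D i)))
  T[D-1,1+i] : term (D - ℤ.1ℤ) (suc i) ≃ (⊖ s ⊛ ((b ⊛ y) ⊛ v)) ⊛ g₁
  T[D-1,1+i] = ⊛-cong (⊛-congˡ (⊖ s) (qpow-cong (termExp-pred-suc D i)))
    (≃-reflexive (cong (λ M → qbinomℤ M (suc i)) (cancel (+ i) D)))
    where
    cancel : ∀ a b → (ℤ.1ℤ + a) + (b - ℤ.1ℤ) ≡ a + b
    cancel = solve-∀
  T[D+1,i] : term (D + ℤ.1ℤ) i ≃ (s ⊛ b) ⊛ g₂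
  T[D+1,i] = ⊛-congˡ (s ⊛ b) (≃-reflexive (cong (λ M → qbinom M i) (trans (cong (i ℕ.+_) (ℕP.+-comm d 1)) (ℕP.+-suc i d))))
  regroup : ∀ s b y v X g₀ g₁ →
    (⊖ s ⊛ (b ⊛ y)) ⊛ (g₀ ⊕ v ⊛ g₁) ⊕ (s ⊛ (b ⊛ X)) ⊛ g₀
      ≃ (⊖ s ⊛ ((b ⊛ y) ⊛ v)) ⊛ g₁ ⊕ (s ⊛ b) ⊛ ((X ⊕ ⊖ y) ⊛ g₀)
  regroup = solveLP-∀ LP-almostCommutativeRing
  commute : ∀ a c g → a ⊛ (c ⊛ g) ≃ c ⊛ (a ⊛ g)
  commute = solveLP-∀ LP-almostCommutativeRing

term-recurrence-neg : ∀ t i → let D = -[1+ t ] in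
  term D (suc i) ⊕ term D i ≃ term (D - ℤ.1ℤ) (suc i) ⊕ (𝟙 ⊕ ⊖ qpow (- (D + ℤ.1ℤ))) ⊛ term (D + ℤ.1ℤ) i
term-recurrence-neg t i = begin
  term D (suc i) ⊕ term D i
    ≈⟨ ⊕-cong (term-vanish D (suc i) ℤ.-<+) (term-vanish D i ℤ.-<+) ⟩
  𝟘 ⊕ 𝟘
    ≈⟨ ⊕-cong (term-vanish (D - ℤ.1ℤ) (suc i) ℤ.-<+) (last t) ⟨
  term (D - ℤ.1ℤ) (suc i) ⊕ (𝟙 ⊕ ⊖ qpow (- (D + ℤ.1ℤ))) ⊛ term (D + ℤ.1ℤ) i
    ∎
  where
  D = -[1+ t ]
  last : ∀ t → (𝟙 ⊕ ⊖ qpow (- (-[1+ t ] + ℤ.1ℤ))) ⊛ term (-[1+ t ] + ℤ.1ℤ) i ≃ 𝟘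
  last zero = ≃-trans (⊛-congʳ (term ℤ.0ℤ i) (⊖-inverseʳ 𝟙)) (⊛-zeroˡ (term ℤ.0ℤ i))
  last (suc t) = ≃-trans (⊛-congˡ c (term-vanish -[1+ t ] i ℤ.-<+)) (⊛-zeroʳ c)
    where c = 𝟙 ⊕ ⊖ qpow (- (-[1+ suc t ] + ℤ.1ℤ))

term-recurrence : ∀ D i →
  term D (suc i) ⊕ term D i ≃ term (D - ℤ.1ℤ) (suc i) ⊕ (𝟙 ⊕ ⊖ qpow (- (D + ℤ.1ℤ))) ⊛ term (D + ℤ.1ℤ) i
term-recurrence (+ d) = term-recurrence-nonneg d
term-recurrence -[1+ t ] = term-recurrence-neg t

-- The constant term

gap : ℕ → ℕ → ℤ
gap n r = + n - + (2 ℕ.* r)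

ctSum : ℕ → ℕ → LP
ctSum n r = conv (binomialDiff n) (term (gap n r)) r

RHS≃ctSum : ∀ n r → RHS n r ≃ qpow (+ r * (+ n - + r)) ⊛ ctSum n r
RHS≃ctSum n r = begin
  RHS n r                ≡⟨ cong (conv X (term (gap n r))) constant-index ⟩
  conv X (term (gap n r)) r  ≈⟨ conv-scaleˡ (term (gap n r)) Q (binomialDiff n) r X≃ ⟩
  Q ⊛ ctSum n r          ∎
  where
  Q = qpow (+ r * (+ n - + r))
  X = conv (conv (binomialDiff n) (fromList (Q ∷ []))) (fromList (𝟙 ∷ []))
  X≃ : ∀ j → X j ≃ Q ⊛ binomialDiff n j
  X≃ j = ≃-trans (conv-constʳ _ 𝟙 j) (≃-trans (⊛-identityʳ _)
           (≃-trans (conv-constʳ (binomialDiff n) Q j) (⊛-comm _ Q)))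
  powW-shift : ∀ n → proj₁ (powW onePlusW n) ≡ 0
  powW-shift zero = refl
  powW-shift (suc n) = powW-shift n
  constant-index : proj₁ (powW onePlusW n) ℕ.+ 0 ℕ.+ r ℕ.+ 0 ≡ r
  constant-index = trans (cong (λ p → p ℕ.+ 0 ℕ.+ r ℕ.+ 0) (powW-shift n)) (ℕP.+-identityʳ r)


gap-pred : ∀ n r → gap n (suc r) ≡ gap (suc n) (suc r) - ℤ.1ℤ
gap-pred n r = rearrange (+ n) (+ r)
  where
  rearrange : ∀ N R →
    N - ((ℤ.1ℤ + R) + ((ℤ.1ℤ + R) + ℤ.0ℤ)) ≡ (ℤ.1ℤ + N) - ((ℤ.1ℤ + R) + ((ℤ.1ℤ + R) + ℤ.0ℤ)) - ℤ.1ℤ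
  rearrange = solve-∀

gap-suc : ∀ n r → gap n r ≡ gap (suc n) (suc r) + ℤ.1ℤ
gap-suc n r = rearrange (+ n) (+ r)
  where
  rearrange : ∀ N R → N - (R + (R + ℤ.0ℤ)) ≡ (ℤ.1ℤ + N) - ((ℤ.1ℤ + R) + ((ℤ.1ℤ + R) + ℤ.0ℤ)) + ℤ.1ℤ
  rearrange = solve-∀

gap≡0⇒n≡1+2r : ∀ n r → gap (suc n) (suc r) ≡ ℤ.0ℤ → n ≡ suc (2 ℕ.* r)
gap≡0⇒n≡1+2r n r gap≡0 =
  ℕP.suc-injective (trans (ℤP.+-injective (ℤP.i-j≡0⇒i≡j (+ suc n) (+ (2 ℕ.* suc r)) gap≡0)) (ℕP.*-suc 2 r))

ctSum-boundary : ∀ n r → let D = gap (suc n) (suc r) in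
  binomialDiff n (suc r) ⊛ (term D 0 ⊕ ⊖ term (D - ℤ.1ℤ) 0) ≃ 𝟘
ctSum-boundary n r with gap (suc n) (suc r) ℤ.≟ ℤ.0ℤ
... | yes gap≡0 = begin
  binomialDiff n (suc r) ⊛ Δ                   ≡⟨ cong (λ m → binomialDiff m (suc r) ⊛ Δ) (gap≡0⇒n≡1+2r n r gap≡0) ⟩
  binomialDiff (suc (2 ℕ.* r)) (suc r) ⊛ Δ     ≈⟨ ⊛-congʳ Δ (binomialDiff-middle r) ⟩
  𝟘 ⊛ Δ                                         ≈⟨ ⊛-zeroˡ Δ ⟩
  𝟘                                             ∎
  where Δ = term (gap (suc n) (suc r)) 0 ⊕ ⊖ term (gap (suc n) (suc r) - ℤ.1ℤ) 0
... | no gap≢0 = begin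
  binomialDiff n (suc r) ⊛ (term D 0 ⊕ ⊖ term (D - ℤ.1ℤ) 0)
    ≈⟨ ⊛-congˡ (binomialDiff n (suc r)) (⊕-congʳ _ (term-zero-pred D gap≢0)) ⟩
  binomialDiff n (suc r) ⊛ (term (D - ℤ.1ℤ) 0 ⊕ ⊖ term (D - ℤ.1ℤ) 0)
    ≈⟨ ⊛-congˡ (binomialDiff n (suc r)) (⊖-inverseʳ (term (D - ℤ.1ℤ) 0)) ⟩
  binomialDiff n (suc r) ⊛ 𝟘
    ≈⟨ ⊛-zeroʳ (binomialDiff n (suc r)) ⟩
  𝟘 ∎
  where D = gap (suc n) (suc r)

ctSum-recurrence : ∀ n r → let D = gap (suc n) (suc r) in
  ctSum (suc n) (suc r) ≃ ctSum n (suc r) ⊕ (𝟙 ⊕ ⊖ qpow (- (D + ℤ.1ℤ))) ⊛ ctSum n r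
ctSum-recurrence n r = begin
  ctSum (suc n) (suc r)
    ≈⟨ conv-pascalˡ P (term D) r (≃-trans (binomialDiff-zero (suc n)) (≃-sym (binomialDiff-zero n))) (binomialDiff-pascal n) ⟩
  conv P (term D) (suc r) ⊕ conv P (term D) r
    ≈⟨ conv-recurrenceʳ P c r (term-recurrence D) ⟩
  (conv P (term (D - ℤ.1ℤ)) (suc r) ⊕ c ⊛ conv P (term (D + ℤ.1ℤ)) r) ⊕ P (suc r) ⊛ (term D 0 ⊕ ⊖ term (D - ℤ.1ℤ) 0)
    ≈⟨ ⊕-congˡ _ (ctSum-boundary n r) ⟩
  (conv P (term (D - ℤ.1ℤ)) (suc r) ⊕ c ⊛ conv P (term (D + ℤ.1ℤ)) r) ⊕ 𝟘
    ≈⟨ ⊕-identityʳ _ ⟩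
  conv P (term (D - ℤ.1ℤ)) (suc r) ⊕ c ⊛ conv P (term (D + ℤ.1ℤ)) r
    ≡⟨ cong₂ (λ D′ D″ → conv P (term D′) (suc r) ⊕ c ⊛ conv P (term D″) r) (gap-pred n r) (gap-suc n r) ⟨
  ctSum n (suc r) ⊕ c ⊛ ctSum n r
    ∎
  where
  D = gap (suc n) (suc r)
  P = binomialDiff n
  c = 𝟙 ⊕ ⊖ qpow (- (D + ℤ.1ℤ))

RHS-recurrence : ∀ n r →
  RHS (suc n) (suc r) ≃ qpow (+ suc r) ⊛ RHS n (suc r) ⊕ (qpow (+ n - + r) ⊕ ⊖ qpow (+ r)) ⊛ RHS n r
RHS-recurrence n r = begin
  RHS (suc n) (suc r)
    ≈⟨ RHS≃ctSum (suc n) (suc r) ⟩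
  Q′ ⊛ ctSum (suc n) (suc r)
    ≈⟨ ⊛-congˡ Q′ (ctSum-recurrence n r) ⟩
  Q′ ⊛ (B₁ ⊕ (𝟙 ⊕ ⊖ y) ⊛ B₀)
    ≈⟨ expand Q′ y B₁ B₀ ⟩
  Q′ ⊛ B₁ ⊕ (Q′ ⊕ ⊖ (Q′ ⊛ y)) ⊛ B₀
    ≈⟨ ⊕-cong (⊛-congʳ B₁ (qpow-cong e₁)) (⊛-congʳ B₀ (⊕-cong (qpow-cong e₂) (⊖-cong (qpow-cong e₃)))) ⟨
  (p₁ ⊛ Q₁) ⊛ B₁ ⊕ (p₂ ⊛ Q₀ ⊕ ⊖ (p₃ ⊛ Q₀)) ⊛ B₀
    ≈⟨ regroup p₁ p₂ p₃ Q₁ Q₀ B₁ B₀ ⟩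
  p₁ ⊛ (Q₁ ⊛ B₁) ⊕ (p₂ ⊕ ⊖ p₃) ⊛ (Q₀ ⊛ B₀)
    ≈⟨ ⊕-cong (⊛-congˡ p₁ (RHS≃ctSum n (suc r))) (⊛-congˡ (p₂ ⊕ ⊖ p₃) (RHS≃ctSum n r)) ⟨
  p₁ ⊛ RHS n (suc r) ⊕ (p₂ ⊕ ⊖ p₃) ⊛ RHS n r
    ∎
  where
  p₁ = qpow (+ suc r)
  p₂ = qpow (+ n - + r)
  p₃ = qpow (+ r)
  Q₁ = qpow (+ suc r * (+ n - + suc r))
  Q₀ = qpow (+ r * (+ n - + r))
  Q′ = qpow (+ suc r * (+ suc n - + suc r))
  B₁ = ctSum n (suc r)
  B₀ = ctSum n r
  y = qpow (- (gap (suc n) (suc r) + ℤ.1ℤ))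
  e₁ : + suc r + + suc r * (+ n - + suc r) ≡ + suc r * (+ suc n - + suc r)
  e₁ = rearrange (+ n) (+ r)
    where
    rearrange : ∀ N R → (ℤ.1ℤ + R) + (ℤ.1ℤ + R) * (N - (ℤ.1ℤ + R)) ≡ (ℤ.1ℤ + R) * ((ℤ.1ℤ + N) - (ℤ.1ℤ + R))
    rearrange = solve-∀
  e₂ : (+ n - + r) + + r * (+ n - + r) ≡ + suc r * (+ suc n - + suc r)
  e₂ = rearrange (+ n) (+ r)
    where
    rearrange : ∀ N R → (N - R) + R * (N - R) ≡ (ℤ.1ℤ + R) * ((ℤ.1ℤ + N) - (ℤ.1ℤ + R))
    rearrange = solve-∀
  e₃ : + r + + r * (+ n - + r) ≡ + suc r * (+ suc n - + suc r) - (gap (suc n) (suc r) + ℤ.1ℤ)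
  e₃ = rearrange (+ n) (+ r)
    where
    rearrange : ∀ N R → R + R * (N - R) ≡
      (ℤ.1ℤ + R) * ((ℤ.1ℤ + N) - (ℤ.1ℤ + R)) - ((ℤ.1ℤ + N) - ((ℤ.1ℤ + R) + ((ℤ.1ℤ + R) + ℤ.0ℤ)) + ℤ.1ℤ)
    rearrange = solve-∀
  expand : ∀ Q y B₁ B₀ → Q ⊛ (B₁ ⊕ (𝟙 ⊕ ⊖ y) ⊛ B₀) ≃ Q ⊛ B₁ ⊕ (Q ⊕ ⊖ (Q ⊛ y)) ⊛ B₀
  expand = solveLP-∀ LP-almostCommutativeRing
  regroup : ∀ p₁ p₂ p₃ Q₁ Q₀ B₁ B₀ →
    (p₁ ⊛ Q₁) ⊛ B₁ ⊕ (p₂ ⊛ Q₀ ⊕ ⊖ (p₃ ⊛ Q₀)) ⊛ B₀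
      ≃ p₁ ⊛ (Q₁ ⊛ B₁) ⊕ (p₂ ⊕ ⊖ p₃) ⊛ (Q₀ ⊛ B₀)
  regroup = solveLP-∀ LP-almostCommutativeRing

RHS-zeroʳ : ∀ n → RHS n 0 ≃ 𝟙
RHS-zeroʳ n = begin
  RHS n 0                                       ≈⟨ RHS≃ctSum n 0 ⟩
  𝟙 ⊛ (binomialDiff n 0 ⊛ term (gap n 0) 0)    ≈⟨ ⊛-identityˡ _ ⟩
  binomialDiff n 0 ⊛ term (gap n 0) 0          ≈⟨ ⊛-cong (binomialDiff-zero n) (term-nonneg-zero (n ℕ.+ 0)) ⟩
  𝟙 ⊛ 𝟙                                         ≈⟨ ⊛-identityˡ 𝟙 ⟩
  𝟙                                             ∎

RHS-zeroˡ : ∀ r → RHS 0 (suc r) ≃ 𝟘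
RHS-zeroˡ r = begin
  RHS 0 (suc r)                                 ≈⟨ RHS≃ctSum 0 (suc r) ⟩
  Q ⊛ ctSum 0 (suc r)                           ≡⟨ cong (Q ⊛_) (conv≡∑ (binomialDiff 0) (term (gap 0 (suc r))) (suc r)) ⟩
  Q ⊛ ∑[ j ≤ suc r ] (binomialDiff 0 j ⊛ term (gap 0 (suc r)) (suc r ∸ j))
    ≈⟨ ⊛-congˡ Q (∑-zero (suc r) λ j _ →
         ≃-trans (⊛-congˡ (binomialDiff 0 j) (term-vanish (gap 0 (suc r)) (suc r ∸ j) ℤ.-<+))
                 (⊛-zeroʳ (binomialDiff 0 j))) ⟩
  Q ⊛ 𝟘                                         ≈⟨ ⊛-zeroʳ Q ⟩
  𝟘                                             ∎
  where Q = qpow (+ suc r * (+ 0 - + suc r))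

A≃RHS : ∀ n r → A n r ≃ RHS n r
A≃RHS zero zero = ≃-sym (RHS-zeroʳ 0)
A≃RHS zero (suc r) = ≃-sym (RHS-zeroˡ r)
A≃RHS (suc n) zero = ≃-sym (RHS-zeroʳ (suc n))
A≃RHS (suc n) (suc r) = ≃-trans
  (⊕-cong (⊛-congˡ (qpow (+ suc r)) (A≃RHS n (suc r))) (⊛-congˡ (qpow (+ n - + r) ⊕ ⊖ qpow (+ r)) (A≃RHS n r)))
  (≃-sym (RHS-recurrence n r))

lemma1 : ∀ (n r : ℕ) → A n r ≈ RHS n r
lemma1 n r = get (A≃RHS n r)
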